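{- For every integer $a\geq 3$ and every integer $m\geq 2a^2-a+2$, the 2-color Rado number of the equation $x_1+x_2+\cdots+x_{m-1}=a x_m$ is $\left\lceil\frac{m-1}{a}\left\lceil\frac{m-1}{a}\right\rceil\right\rceil$.
   Context: For an integer $n\ge 1$ let $[n]=\{1,\ldots,n\}$. A solution of the equation $x_1+\cdots+x_{m-1}=ax_m$ in $[n]$ is an assignment of values in $[n]$ to $x_1,\ldots,x_m$ (not necessarily distinct) making the equation true; given a coloring of $[n]$, the solution is monochromatic if all the values $x_1,\ldots,x_m$ receive the same color. The 2-color Rado number of the equation is the smallest positive integer $n$ such that every coloring of $[n]$ with two colors admits a monochromatic solution in $[n]$. -}

module Defs where

open import Data.Nat using (ℕ; zero; suc; _+_; _*_; _∸_; _≤_; _<_; _/_; NonZero)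
open import Data.Bool using (Bool)
open import Data.Fin using (Fin)
open import Data.Vec.Functional using (foldr)
open import Data.Product using (Σ; _×_; ∃-syntax)
open import Relation.Binary.PropositionalEquality using (_≡_)
open import Relation.Nullary using (¬_)

InRange : ℕ → ℕ → Set
InRange n x = 1 ≤ x × x ≤ n

-- A 2-coloring of [n]; only its values on [n] matter.
Coloring : Set
Coloring = ℕ → Bool

sumF : ∀ {k} → (Fin k → ℕ) → ℕ
sumF = foldr _+_ 0

-- A monochromatic solution in [n] of x₁ + ⋯ + x_{m-1} = a·x_m under c:
-- xs gives x₁ … x_{m-1}, y gives x_m.
MonoSolution : (m a n : ℕ) → Coloring → Set
MonoSolution m a n c =
  Σ (Fin (m ∸ 1) → ℕ) λ xs → Σ ℕ λ y →
    (∀ i → InRange n (xs i)) × InRange n y ×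
    (sumF xs ≡ a * y) ×
    (∀ i → c (xs i) ≡ c y)

Forced : (m a n : ℕ) → Set
Forced m a n = (c : Coloring) → MonoSolution m a n c

IsRadoNumber : (m a n : ℕ) → Set
IsRadoNumber m a n = 1 ≤ n × Forced m a n × (∀ k → 1 ≤ k → k < n → ¬ Forced m a k)

ceilDiv : (p q : ℕ) → .{{NonZero q}} → ℕ
ceilDiv p q = (p + (q ∸ 1)) / q

module Submission where

-- With a = 3 + p and s = m − 1 = a + T summands, the hypothesis says exactly
-- k = ⌈s/a⌉ ≥ 2a; the claim is that the Rado number is n = ⌈s·k/a⌉.
--
-- Lower bound: colour [1, k) red and [k, ∞) blue.  A red solution would need
-- s ≤ a·y < a·k, a blue one s·k ≤ a·y < a·n; both contradict the ceilings.
--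
-- Upper bound: call the colour of 1 red and let b be the least blue number of
-- [1, k].  Solutions are assembled from blocks of equal summands.  If there is
-- no such b, the filling lemma (a − d copies of y plus T + d numbers of [1, B]
-- summing to d·y) gives a red solution with y = k.  If b = 2, a finite case
-- analysis on the colours of 3, 4, 5, t = T + 1 and 2t, split by the parity
-- of T, does it.  If b ≥ 3, complete (a − 1 + T)·b by some w ∈ [k, k + a) to
-- a multiple a·Y: if w or Y is red the filling lemma applies with B = b − 1,
-- otherwise (a − 1 + T) copies of b and w are a blue solution.

open import Defs
open import Data.Nat
  using (ℕ; zero; suc; _+_; _*_; _∸_; _≤_; _<_; _%_; z≤n; s≤s; _≤?_; _<ᵇ_; NonZero)
open import Data.Nat.Properties
open import Data.Nat.DivMod using (m≡m%n+[m/n]*n; m%n<n)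
open import Data.Nat.Tactic.RingSolver using (solve-∀)
open import Data.Bool using (Bool; true; false; not) renaming (T to True)
open import Data.Unit using (tt)
open import Data.Fin using (Fin; zero; suc)
open import Data.Product using (Σ; _×_; _,_; proj₁; proj₂)
open import Data.Sum using (_⊎_; inj₁; inj₂)
open import Relation.Binary.PropositionalEquality
open import Relation.Nullary using (¬_; yes; no)

≤-offset : ∀ {x y} d → y ≡ x + d → x ≤ y
≤-offset {x} d eq = subst (x ≤_) (sym eq) (m≤m+n x d)

+≤* : ∀ x y → 2 ≤ x → 2 ≤ y → x + y ≤ x * y
+≤* (suc (suc x)) (suc (suc y)) (s≤s (s≤s z≤n)) (s≤s (s≤s z≤n)) =
  ≤-offset (x + y + x * y) (expand x y)
  where
  expand : ∀ x y → (2 + x) * (2 + y) ≡ (2 + x) + (2 + y) + (x + y + x * y)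
  expand = solve-∀

*-cancel-slack : ∀ q x y → suc q * x ≤ suc q * y + q → x ≤ y
*-cancel-slack q x y le = ≤-pred (*-cancelˡ-< (suc q) x (suc y) (begin-strict
  suc q * x       ≤⟨ le ⟩
  suc q * y + q   <⟨ +-monoʳ-< (suc q * y) (n<1+n q) ⟩
  suc q * y + suc q ≡⟨ +-comm (suc q * y) (suc q) ⟩
  suc q + suc q * y ≡⟨ *-suc (suc q) y ⟨
  suc q * suc y   ∎))
  where open ≤-Reasoning

*-suc-<-cancel : ∀ a y t → a * suc y < t + a → a * y < t
*-suc-<-cancel a y t lt =
  +-cancelˡ-< a (a * y) t (subst₂ _<_ (*-suc a y) (+-comm t a) lt)

factor-positive : ∀ a y {s} → suc s ≤ a * y → 1 ≤ y
factor-positive a zero {s} le with subst (suc s ≤_) (*-zeroʳ a) le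
... | ()
factor-positive a (suc y) _ = s≤s z≤n

module _ (x q : ℕ) where
  private
    Q : ℕ
    Q = ceilDiv x (suc q)

    division : x + q ≡ (x + q) % suc q + Q * suc q
    division = m≡m%n+[m/n]*n (x + q) (suc q)

  ceilDiv-lower : x ≤ suc q * ceilDiv x (suc q)
  ceilDiv-lower = subst (x ≤_) (*-comm Q (suc q)) (+-cancelʳ-≤ q x (Q * suc q) bound)
    where
    open ≤-Reasoning
    bound : x + q ≤ Q * suc q + q
    bound = begin
      x + q                   ≡⟨ division ⟩
      (x + q) % suc q + Q * suc q
        ≤⟨ +-monoˡ-≤ (Q * suc q) (≤-pred (m%n<n (x + q) (suc q))) ⟩
      q + Q * suc q           ≡⟨ +-comm q (Q * suc q) ⟩
      Q * suc q + q           ∎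

  ceilDiv-upper : suc q * ceilDiv x (suc q) ≤ x + q
  ceilDiv-upper = subst₂ _≤_ (*-comm Q (suc q)) (sym division) (m≤n+m (Q * suc q) _)

roundUp : ∀ x q → Σ ℕ λ D → D ≤ q × x + D ≡ suc q * ceilDiv x (suc q)
roundUp x q = D , D≤q , m+[n∸m]≡n (ceilDiv-lower x q)
  where
  D : ℕ
  D = suc q * ceilDiv x (suc q) ∸ x
  D≤q : D ≤ q
  D≤q = subst (D ≤_) (m+n∸m≡n x q) (∸-monoˡ-≤ x (ceilDiv-upper x q))

leastMultiple : ∀ T y e₀ → T ≤ suc e₀ * y →
  Σ ℕ λ e → e ≤ e₀ × T ≤ suc e * y × (e ≡ 0 ⊎ e * y < T)
leastMultiple T y zero le = 0 , z≤n , le , inj₁ refl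
leastMultiple T y (suc e₀) le with T ≤? suc e₀ * y
... | no  T≰ = suc e₀ , ≤-refl , le , inj₂ (≰⇒> T≰)
... | yes T≤ with leastMultiple T y e₀ T≤
...   | e , e≤e₀ , T≤dy , least = e , m≤n⇒m≤1+n e≤e₀ , T≤dy , least

-- the size conditions of the filling lemma for d = e + 1 and y + 1:
-- T + d summands of size ≥ 1 fit below d·(y + 1) ...
fill-lower : ∀ T y d → T ≤ d * y → (T + d) * 1 ≤ d * suc y
fill-lower T y d T≤dy = subst₂ _≤_ (sym (*-identityʳ (T + d))) (sym (*-suc d y))
  (subst (_≤ d + d * y) (+-comm d T) (+-monoʳ-≤ d T≤dy))

-- ... and, d being least (fill-upper's last hypothesis), also summands ≤ B suffice
fill-upper : ∀ T y e B → 2 ≤ B → suc y ≤ suc T * B → (e ≡ 0 ⊎ e * y < T) →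
  suc e * suc y ≤ (T + suc e) * B
fill-upper T y zero B _ y≤ _ =
  subst₂ _≤_ (sym (+-identityʳ (suc y))) (cong (_* B) (+-comm 1 T)) y≤
fill-upper T y (suc e) B _ _ (inj₁ ())
fill-upper T y (suc e) B 2≤B _ (inj₂ ey<T) = begin
  (2 + e) * suc y              ≡⟨ expand e y ⟩
  (2 + e) + (y + suc e * y)     ≤⟨ +-monoʳ-≤ (2 + e) (+-mono-≤ y≤T (<⇒≤ ey<T)) ⟩
  (2 + e) + (T + T)             ≤⟨ ≤-offset (2 + e) (double e T) ⟩
  (T + (2 + e)) * 2             ≤⟨ *-monoʳ-≤ (T + (2 + e)) 2≤B ⟩
  (T + (2 + e)) * B             ∎
  where
  open ≤-Reasoning
  y≤T : y ≤ T
  y≤T = <⇒≤ (≤-<-trans (m≤n*m y (suc e)) ey<T)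
  expand : ∀ e y → (2 + e) * suc y ≡ (2 + e) + (y + suc e * y)
  expand = solve-∀
  double : ∀ e T → (T + (2 + e)) * 2 ≡ ((2 + e) + (T + T)) + (2 + e)
  double = solve-∀

module Colour (n : ℕ) (c : Coloring) (colour : Bool) where

  Good : ℕ → Set
  Good x = InRange n x × c x ≡ colour

  record Rep (count total : ℕ) : Set where
    constructor rep
    field
      parts : Fin count → ℕ
      good  : ∀ i → Good (parts i)
      sums  : sumF parts ≡ total

  infixr 5 _◃_ _⊕_

  ∅ : Rep 0 0
  ∅ = rep (λ ()) (λ ()) refl

  _◃_ : ∀ {x count total} → Good x → Rep count total → Rep (suc count) (x + total)
  _◃_ {x} gx (rep xs g eq) = rep parts good (cong (x +_) eq)
    where
    parts : Fin _ → ℕ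
    parts zero    = x
    parts (suc i) = xs i
    good : ∀ i → Good (parts i)
    good zero    = gx
    good (suc i) = g i

  copies : ∀ k {v} → Good v → Rep k (k * v)
  copies zero    gv = ∅
  copies (suc k) gv = gv ◃ copies k gv

  _⊕_ : ∀ {p q t u} → Rep p t → Rep q u → Rep (p + q) (t + u)
  _⊕_ {zero}          (rep xs g refl) r = r
  _⊕_ {suc p} {u = u} (rep xs g refl) r =
    subst (Rep _) (sym (+-assoc (xs zero) (sumF (λ i → xs (suc i))) u))
      (g zero ◃ (rep (λ i → xs (suc i)) (λ i → g (suc i)) refl ⊕ r))

  interval : ∀ {lo hi} → (∀ x → lo ≤ x → x ≤ hi → Good x) → lo ≤ hi →
             ∀ count total → count * lo ≤ total → total ≤ count * hi → Rep count total
  interval good lo≤hi zero total _ total≤0 with n≤0⇒n≡0 total≤0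
  ... | refl = ∅
  interval {lo} {hi} good lo≤hi (suc count) total low high
    with total ∸ count * lo ≤? hi
  ... | yes rest≤hi =
    subst (Rep _) (m∸n+n≡m low′)
      (good _ lo≤rest rest≤hi ◃
       interval good lo≤hi count (count * lo) ≤-refl (*-monoʳ-≤ count lo≤hi))
    where
    low′ : count * lo ≤ total
    low′ = ≤-trans (m≤n+m (count * lo) lo) low
    lo≤rest : lo ≤ total ∸ count * lo
    lo≤rest = subst (_≤ total ∸ count * lo) (m+n∸n≡m lo (count * lo))
                (∸-monoˡ-≤ (count * lo) low)
  ... | no rest≰hi =
    subst (Rep _) (m+[n∸m]≡n hi≤total)
      (good _ lo≤hi ≤-refl ◃ interval good lo≤hi count (total ∸ hi) low′ high′)
    where
    hi+<total : hi + count * lo < total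
    hi+<total = subst (_< total) (+-comm (count * lo) hi)
      (subst (count * lo + hi <_) (m+[n∸m]≡n (≤-trans (m≤n+m (count * lo) lo) low))
        (+-monoʳ-< (count * lo) (≰⇒> rest≰hi)))
    hi≤total : hi ≤ total
    hi≤total = ≤-trans (m≤m+n hi (count * lo)) (<⇒≤ hi+<total)
    low′ : count * lo ≤ total ∸ hi
    low′ = subst (_≤ total ∸ hi) (m+n∸m≡n hi (count * lo)) (∸-monoˡ-≤ hi (<⇒≤ hi+<total))
    high′ : total ∸ hi ≤ count * hi
    high′ = subst (total ∸ hi ≤_) (m+n∸m≡n hi (count * hi)) (∸-monoˡ-≤ hi high)

  solution : ∀ a {s y count total} → Rep count total → count ≡ s → total ≡ a * y →
             Good y → MonoSolution (suc s) a n c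
  solution a {y = y} (rep xs g eq) refl refl gy =
    xs , y , (λ i → proj₁ (g i)) , proj₁ gy , eq ,
    (λ i → trans (proj₂ (g i)) (sym (proj₂ gy)))

  -- If [1, B] (B ≥ 2) and y are good, s = a + T ≤ a·y and
  -- y ≤ (T + 1)·B, then a − d copies of y and T + d numbers of [1, B] with
  -- sum d·y form a solution, d ≥ 1 being least with T ≤ d·(y − 1).
  fill : ∀ q T {B y} → 2 ≤ B → (∀ x → 1 ≤ x → x ≤ B → Good x) → Good y →
         suc q + T ≤ suc q * y → y ≤ suc T * B → MonoSolution (suc (suc q + T)) (suc q) n c
  fill q T {B} {zero} _ _ ((() , _) , _)
  fill q T {B} {suc y} 2≤B small gy s≤ay y≤
    with leastMultiple T y q (+-cancelˡ-≤ (suc q) T (suc q * y)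
                                (subst (suc q + T ≤_) (*-suc (suc q) y) s≤ay))
  ... | e , e≤q , T≤dy , least =
    solution (suc q) (copies (suc q ∸ suc e) gy ⊕
              interval small (≤-trans (s≤s z≤n) 2≤B) (T + suc e) (suc e * suc y)
                (fill-lower T y (suc e) T≤dy) (fill-upper T y e B 2≤B y≤ least))
             count≡ sum≡ gy
    where
    d≤a : suc e ≤ suc q
    d≤a = s≤s e≤q
    count≡ : (suc q ∸ suc e) + (T + suc e) ≡ suc q + T
    count≡ = trans (cong ((suc q ∸ suc e) +_) (+-comm T (suc e)))
               (trans (sym (+-assoc (suc q ∸ suc e) (suc e) T))
                      (cong (_+ T) (m∸n+n≡m {suc q} {suc e} d≤a)))
    sum≡ : (suc q ∸ suc e) * suc y + suc e * suc y ≡ suc q * suc y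
    sum≡ = trans (sym (*-distribʳ-+ (suc y) (suc q ∸ suc e) (suc e)))
             (cong (_* suc y) (m∸n+n≡m {suc q} {suc e} d≤a))

-- The lower bound

threshold : ℕ → Coloring
threshold k x = x <ᵇ k

threshold-cases : ∀ k x → (threshold k x ≡ true × x < k) ⊎ (threshold k x ≡ false × k ≤ x)
threshold-cases k x with x <ᵇ k in eq
... | true  = inj₁ (refl , <ᵇ⇒< x k (subst True (sym eq) tt))
... | false = inj₂ (refl , ≮⇒≥ (λ x<k → subst True eq (<⇒<ᵇ x<k)))

sumF-≥ : ∀ {count} (xs : Fin count → ℕ) lo → (∀ i → lo ≤ xs i) → count * lo ≤ sumF xs
sumF-≥ {zero}    xs lo _  = z≤n
sumF-≥ {suc count} xs lo lo≤ =
  +-mono-≤ (lo≤ zero) (sumF-≥ (λ i → xs (suc i)) lo (λ i → lo≤ (suc i)))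

-- If a·k < s + a and a·(n' + 1) < s·k + a, the threshold colouring at k has no
-- monochromatic solution in [n']: red ones have a·y < s, blue ones a·y < s·k.
thresholdAvoids : ∀ s a k n' → a * k < s + a → a * suc n' < s * k + a →
                  ¬ MonoSolution (suc s) a n' (threshold k)
thresholdAvoids s a k n' ak< an'< (xs , y , xs∈ , (_ , y≤n') , sum≡ , same)
  with threshold-cases k y
... | inj₁ (_ , y<k) = <-irrefl refl (≤-<-trans s≤ay ay<s)
  where
  s≤ay : s ≤ a * y
  s≤ay = subst₂ _≤_ (*-identityʳ s) sum≡ (sumF-≥ xs 1 (λ i → proj₁ (xs∈ i)))
  ay<s : a * y < s
  ay<s = *-suc-<-cancel a y s (≤-<-trans (*-monoʳ-≤ a y<k) ak<)
... | inj₂ (blueY , k≤y) = <-irrefl refl (≤-<-trans sk≤ay ay<sk)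
  where
  k≤xs : ∀ i → k ≤ xs i
  k≤xs i with threshold-cases k (xs i)
  ... | inj₂ (_ , k≤x) = k≤x
  ... | inj₁ (redX , _) with trans (sym redX) (trans (same i) blueY)
  ...   | ()
  sk≤ay : s * k ≤ a * y
  sk≤ay = subst (s * k ≤_) sum≡ (sumF-≥ xs k k≤xs)
  ay<sk : a * y < s * k
  ay<sk = *-suc-<-cancel a y (s * k) (≤-<-trans (*-monoʳ-≤ a (s≤s y≤n')) an'<)

dichotomy : ∀ (b r : Bool) → b ≡ r ⊎ b ≡ not r
dichotomy false false = inj₁ refl
dichotomy false true  = inj₂ refl
dichotomy true  false = inj₂ refl
dichotomy true  true  = inj₁ refl

module TwoColours (n : ℕ) (c : Coloring) where
  module Red  = Colour n c (c 1)
  module Blue = Colour n c (not (c 1))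

  redOrBlue : ∀ {x} → InRange n x → Red.Good x ⊎ Blue.Good x
  redOrBlue {x} x∈ with dichotomy (c x) (c 1)
  ... | inj₁ red  = inj₁ (x∈ , red)
  ... | inj₂ blue = inj₂ (x∈ , blue)

FirstBlue : Coloring → ℕ → Set
FirstBlue c j = (∀ x → 1 ≤ x → x ≤ j → c x ≡ c 1) ⊎
  Σ ℕ λ e → 2 + e ≤ j × c (2 + e) ≡ not (c 1) × (∀ x → 1 ≤ x → x < 2 + e → c x ≡ c 1)

firstBlue : ∀ c j → FirstBlue c j
firstBlue c zero = inj₁ λ { x (s≤s _) () }
firstBlue c (suc zero) = inj₁ λ x 1≤x x≤1 → cong c (≤-antisym x≤1 1≤x)
firstBlue c (suc (suc e)) with firstBlue c (suc e)
... | inj₂ (e′ , b≤ , blueB , belowRed) = inj₂ (e′ , m≤n⇒m≤1+n b≤ , blueB , belowRed)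
... | inj₁ upTo with dichotomy (c (2 + e)) (c 1)
...   | inj₂ blue = inj₂ (e , ≤-refl , blue , λ x 1≤x x<b → upTo x 1≤x (≤-pred x<b))
...   | inj₁ red  = inj₁ λ x 1≤x x≤b → extend x 1≤x (m≤n⇒m<n∨m≡n x≤b)
  where
  extend : ∀ x → 1 ≤ x → x < 2 + e ⊎ x ≡ 2 + e → c x ≡ c 1
  extend x 1≤x (inj₁ x<b)  = upTo x 1≤x (≤-pred x<b)
  extend x 1≤x (inj₂ refl) = red

-- The case b = 2

module SecondBlue (p T n : ℕ) (c : Coloring)
                  (6≤T : 6 ≤ T) (2t≤n : 2 * suc T ≤ n) (blue2 : c 2 ≡ not (c 1)) where
  open TwoColours n c public

  t : ℕ
  t = suc T

  Solution : Set
  Solution = MonoSolution (suc (3 + p + T)) (3 + p) n c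

  t∈ : InRange n t
  t∈ = s≤s z≤n , ≤-trans (m≤m+n t (t + 0)) 2t≤n

  small∈ : ∀ x → 1 ≤ x → x ≤ 5 → InRange n x
  small∈ x 1≤x x≤5 =
    1≤x , ≤-trans x≤5 (≤-trans (≤-trans (n≤1+n 5) 6≤T) (≤-trans (n≤1+n T) (proj₂ t∈)))

  red1 : Red.Good 1
  red1 = small∈ 1 ≤-refl (s≤s z≤n) , refl

  blue2′ : Blue.Good 2
  blue2′ = small∈ 2 (s≤s z≤n) (s≤s (s≤s z≤n)) , blue2

  private
    count : ∀ p T → (2 + p) + suc T ≡ 3 + p + T
    count = solve-∀
    sum-t : ∀ p t → (2 + p) * t + t * 1 ≡ (3 + p) * t
    sum-t = solve-∀
    sum-2t : ∀ p t → (2 + p) * (2 * t) + t * 2 ≡ (3 + p) * (2 * t)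
    sum-2t = solve-∀

  -- Unless a solution appears at once, t is blue and 2t is red:
  -- otherwise (a − 1)·t + t·1 = a·t is red or (a − 1)·2t + t·2 = a·2t is blue.
  tBlue-2tRed : Solution ⊎ (Blue.Good t × Red.Good (2 * t))
  tBlue-2tRed with redOrBlue t∈ | redOrBlue {2 * t} (s≤s z≤n , 2t≤n)
  ... | inj₁ redT  | _ = inj₁ (let open Red in
    solution (3 + p) (copies (2 + p) redT ⊕ copies t red1) (count p T) (sum-t p t) redT)
  ... | inj₂ blueT | inj₂ blue2T = inj₁ (let open Blue in
    solution (3 + p) (copies (2 + p) blue2T ⊕ copies t blue2′) (count p T) (sum-2t p t) blue2T)
  ... | inj₂ blueT | inj₁ red2T = inj₂ (blueT , red2T)

private
  even-blue-count : ∀ p r → p + (6 + (4 + (r + r))) ≡ 3 + p + (7 + (r + r))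
  even-blue-count = solve-∀
  even-blue-sum : ∀ p r → p * (8 + (r + r)) + (6 * 2 + (4 + (r + r)) * 3) ≡ (3 + p) * (8 + (r + r))
  even-blue-sum = solve-∀
  even-red-count : ∀ p r → (2 + p) + ((4 + r) + (4 + r)) ≡ 3 + p + (7 + (r + r))
  even-red-count = solve-∀
  even-red-sum : ∀ p r → (2 + p) * (2 * (8 + (r + r))) + ((4 + r) * 3 + (4 + r) * 1) ≡
                         (3 + p) * (2 * (8 + (r + r)))
  even-red-sum = solve-∀

-- T = 7 + 2r, t = 8 + 2r:  if 3 is blue, (a − 3)·t + 6·2 + (4 + 2r)·3 = a·t;
-- if 3 is red,  (a − 1)·2t + (4 + r)·3 + (4 + r)·1 = a·2t.
secondBlueEven : ∀ p r n c → 2 * (8 + (r + r)) ≤ n → c 2 ≡ not (c 1) →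
                 MonoSolution (suc (3 + p + (7 + (r + r)))) (3 + p) n c
secondBlueEven p r n c 2t≤n blue2 = result
  where
  open SecondBlue p (7 + (r + r)) n c (m≤m+n 6 (1 + (r + r))) 2t≤n blue2
  result : Solution
  result with tBlue-2tRed | redOrBlue (small∈ 3 (s≤s z≤n) (s≤s (s≤s (s≤s z≤n))))
  ... | inj₁ sol | _ = sol
  ... | inj₂ (blueT , _) | inj₂ blue3 = let open Blue in
    solution (3 + p) (copies p blueT ⊕ copies 6 blue2′ ⊕ copies (4 + (r + r)) blue3)
      (even-blue-count p r) (even-blue-sum p r) blueT
  ... | inj₂ (_ , red2T) | inj₁ red3 = let open Red in
    solution (3 + p) (copies (2 + p) red2T ⊕ copies (4 + r) red3 ⊕ copies (4 + r) red1)
      (even-red-count p r) (even-red-sum p r) red2T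

private
  odd-blue3-count : ∀ p r → p + (6 + (3 + (r + r))) ≡ 3 + p + (6 + (r + r))
  odd-blue3-count = solve-∀
  odd-blue3-sum : ∀ p r → p * (7 + (r + r)) + (6 * 2 + (3 + (r + r)) * 3) ≡ (3 + p) * (7 + (r + r))
  odd-blue3-sum = solve-∀
  odd-red4-count : ∀ p r → (2 + p) + (1 + ((2 + r) + (4 + r))) ≡ 3 + p + (6 + (r + r))
  odd-red4-count = solve-∀
  odd-red4-sum : ∀ p r → (2 + p) * (2 * (7 + (r + r))) + (1 * 4 + ((2 + r) * 3 + (4 + r) * 1)) ≡
                         (3 + p) * (2 * (7 + (r + r)))
  odd-red4-sum = solve-∀
  odd-red5-count : ∀ p r → (1 + p) + ((6 + r) + (2 + r)) ≡ 3 + p + (6 + (r + r))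
  odd-red5-count = solve-∀
  odd-red5-sum : ∀ p r → (1 + p) * (2 * (7 + (r + r))) + ((6 + r) * 3 + (2 + r) * 5) ≡
                         (3 + p) * (2 * (7 + (r + r)))
  odd-red5-sum = solve-∀
  odd-blue5-count : ∀ p r → p + ((8 + r) + (r + 1)) ≡ 3 + p + (6 + (r + r))
  odd-blue5-count = solve-∀
  odd-blue5-sum : ∀ p r → p * (7 + (r + r)) + ((8 + r) * 2 + (r * 4 + 1 * 5)) ≡ (3 + p) * (7 + (r + r))
  odd-blue5-sum = solve-∀

-- T = 6 + 2r, t = 7 + 2r, according to the colours of 3, 4, 5:
--   3 blue:             (a − 3)·t + 6·2 + (3 + 2r)·3             = a·t   (blue)
--   3, 4 red:           (a − 1)·2t + 1·4 + (2 + r)·3 + (4 + r)·1 = a·2t  (red)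
--   3, 5 red, 4 blue:   (a − 2)·2t + (6 + r)·3 + (2 + r)·5       = a·2t  (red)
--   3 red, 4, 5 blue:   (a − 3)·t + (8 + r)·2 + r·4 + 1·5        = a·t   (blue)
secondBlueOdd : ∀ p r n c → 2 * (7 + (r + r)) ≤ n → c 2 ≡ not (c 1) →
                MonoSolution (suc (3 + p + (6 + (r + r)))) (3 + p) n c
secondBlueOdd p r n c 2t≤n blue2 = result
  where
  open SecondBlue p (6 + (r + r)) n c (m≤m+n 6 (r + r)) 2t≤n blue2
  result : Solution
  result with tBlue-2tRed
            | redOrBlue (small∈ 3 (s≤s z≤n) (s≤s (s≤s (s≤s z≤n))))
            | redOrBlue (small∈ 4 (s≤s z≤n) (s≤s (s≤s (s≤s (s≤s z≤n)))))
            | redOrBlue (small∈ 5 (s≤s z≤n) ≤-refl)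
  ... | inj₁ sol | _ | _ | _ = sol
  ... | inj₂ (blueT , _) | inj₂ blue3 | _ | _ = let open Blue in
    solution (3 + p) (copies p blueT ⊕ copies 6 blue2′ ⊕ copies (3 + (r + r)) blue3)
      (odd-blue3-count p r) (odd-blue3-sum p r) blueT
  ... | inj₂ (_ , red2T) | inj₁ red3 | inj₁ red4 | _ = let open Red in
    solution (3 + p)
      (copies (2 + p) red2T ⊕ copies 1 red4 ⊕ copies (2 + r) red3 ⊕ copies (4 + r) red1)
      (odd-red4-count p r) (odd-red4-sum p r) red2T
  ... | inj₂ (_ , red2T) | inj₁ red3 | inj₂ _ | inj₁ red5 = let open Red in
    solution (3 + p) (copies (1 + p) red2T ⊕ copies (6 + r) red3 ⊕ copies (2 + r) red5)
      (odd-red5-count p r) (odd-red5-sum p r) red2T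
  ... | inj₂ (blueT , _) | inj₁ _ | inj₂ blue4 | inj₂ blue5 = let open Blue in
    solution (3 + p)
      (copies p blueT ⊕ copies (8 + r) blue2′ ⊕ copies r blue4 ⊕ copies 1 blue5)
      (odd-blue5-count p r) (odd-blue5-sum p r) blueT

parity : ∀ u → Σ ℕ (λ r → u ≡ r + r) ⊎ Σ ℕ (λ r → u ≡ suc (r + r))
parity zero = inj₁ (0 , refl)
parity (suc u) with parity u
... | inj₁ (r , refl) = inj₂ (r , refl)
... | inj₂ (r , refl) = inj₁ (suc r , cong suc (sym (+-suc r r)))

secondBlue : ∀ p T n c → 6 ≤ T → 2 * suc T ≤ n → c 2 ≡ not (c 1) →
             MonoSolution (suc (3 + p + T)) (3 + p) n c
secondBlue p T n c 6≤T with m≤n⇒∃[o]m+o≡n 6≤T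
... | u , refl with parity u
...   | inj₁ (r , refl) = secondBlueOdd p r n c
...   | inj₂ (r , refl) = secondBlueEven p r n c

-- The case b ≥ 3

private
  quotient-expand : ∀ p v e → (3 + p) * ((2 + v) * (2 + e)) ≡
    ((2 + p + (1 + v)) * (3 + e) + (1 + v) + (2 + p)) +
    ((2 + 2 * p) * v + e * (1 + v) * (2 + p) + e)
  quotient-expand = solve-∀

quotient-bound : ∀ p T e → 1 ≤ T →
  (2 + p + T) * (3 + e) + T + (2 + p) ≤ (3 + p) * (suc T * (2 + e))
quotient-bound p (suc v) e _ = ≤-offset _ (quotient-expand p v e)

module LargeFirstBlue (p T k n : ℕ) (c : Coloring) (e : ℕ)
    (b≤k : 3 + e ≤ k) (blueB : c (3 + e) ≡ not (c 1))
    (belowRed : ∀ x → 1 ≤ x → x < 3 + e → c x ≡ c 1)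
    (k≤T : k ≤ T) (a≤T : 3 + p ≤ T) (s≤ak : 3 + p + T ≤ (3 + p) * k)
    (sk≤an : (3 + p + T) * k ≤ (3 + p) * n) (2t≤n : 2 * suc T ≤ n) where
  open TwoColours n c

  2≤b-1 : 2 ≤ 2 + e
  2≤b-1 = m≤m+n 2 e

  k≤n : k ≤ n
  k≤n = ≤-trans k≤T (≤-trans (≤-trans (n≤1+n T) (m≤m+n (suc T) (suc T + 0))) 2t≤n)

  belowB-red : ∀ x → 1 ≤ x → x ≤ 2 + e → Red.Good x
  belowB-red x 1≤x x≤ =
    (1≤x , ≤-trans (m≤n⇒m≤1+n x≤) (≤-trans b≤k k≤n)) , belowRed x 1≤x (s≤s x≤)

  b-blue : Blue.Good (3 + e)
  b-blue = (s≤s z≤n , ≤-trans b≤k k≤n) , blueB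

  -- w = k + D with D < a completes the block (a − 1 + T)·b to a multiple a·Y
  A : ℕ
  A = (2 + p + T) * (3 + e) + k

  Y : ℕ
  Y = ceilDiv A (3 + p)

  rounding : Σ ℕ λ D → D ≤ 2 + p × A + D ≡ (3 + p) * Y
  rounding = roundUp A (2 + p)

  D : ℕ
  D = proj₁ rounding

  w : ℕ
  w = k + D

  completes : (2 + p + T) * (3 + e) + w ≡ (3 + p) * Y
  completes = trans (sym (+-assoc ((2 + p + T) * (3 + e)) k D))
                    (proj₂ (proj₂ rounding))

  -- w and Y are both small enough for the filling lemma with B = b − 1
  w≤2t : w ≤ 2 * suc T
  w≤2t = +-mono-≤ (m≤n⇒m≤1+n k≤T)
    (≤-trans (proj₁ (proj₂ rounding))
      (≤-trans (≤-trans (n≤1+n (2 + p)) a≤T) (≤-trans (n≤1+n T) (m≤m+n (suc T) 0))))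

  w∈ : InRange n w
  w∈ = ≤-trans (s≤s z≤n) (≤-trans b≤k (m≤m+n k D)) , ≤-trans w≤2t 2t≤n

  w≤tB : w ≤ suc T * (2 + e)
  w≤tB = ≤-trans w≤2t (subst (_≤ suc T * (2 + e)) (*-comm (suc T) 2) (*-monoʳ-≤ (suc T) 2≤b-1))

  aY≤ : (3 + p) * Y ≤ A + (2 + p)
  aY≤ = ceilDiv-upper A (2 + p)

  s≤aY : 3 + p + T ≤ (3 + p) * Y
  s≤aY = subst (3 + p + T ≤_) completes
    (subst (_≤ (2 + p + T) * (3 + e) + w) (+-comm (2 + p + T) 1)
      (+-mono-≤ (m≤m*n (2 + p + T) (3 + e)) (proj₁ w∈)))

  Y≤n : Y ≤ n
  Y≤n = *-cancel-slack (2 + p) Y n (≤-trans aY≤ (+-monoˡ-≤ (2 + p) A≤an))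
    where
    open ≤-Reasoning
    A≤an : A ≤ (3 + p) * n
    A≤an = begin
      (2 + p + T) * (3 + e) + k ≤⟨ +-monoˡ-≤ k (*-monoʳ-≤ (2 + p + T) b≤k) ⟩
      (2 + p + T) * k + k       ≡⟨ +-comm ((2 + p + T) * k) k ⟩
      (3 + p + T) * k           ≤⟨ sk≤an ⟩
      (3 + p) * n               ∎

  Y∈ : InRange n Y
  Y∈ = factor-positive (3 + p) Y s≤aY , Y≤n

  Y≤tB : Y ≤ suc T * (2 + e)
  Y≤tB = *-cancelˡ-≤ (3 + p)
    (≤-trans aY≤ (≤-trans (+-monoˡ-≤ (2 + p) (+-monoʳ-≤ ((2 + p + T) * (3 + e)) k≤T))
                          (quotient-bound p T e (≤-trans (s≤s z≤n) a≤T))))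

  -- w red or Y red: fill; both blue: (a − 1 + T)·b + 1·w = a·Y
  result : MonoSolution (suc (3 + p + T)) (3 + p) n c
  result with redOrBlue w∈ | redOrBlue Y∈
  ... | inj₁ redW | _ =
    Red.fill (2 + p) T 2≤b-1 belowB-red redW (≤-trans s≤ak (*-monoʳ-≤ (3 + p) (m≤m+n k D))) w≤tB
  ... | inj₂ _ | inj₁ redY = Red.fill (2 + p) T 2≤b-1 belowB-red redY s≤aY Y≤tB
  ... | inj₂ blueW | inj₂ blueY = let open Blue in
    solution (3 + p) (copies (2 + p + T) b-blue ⊕ copies 1 blueW) (+-comm (2 + p + T) 1)
      (trans (cong ((2 + p + T) * (3 + e) +_) (+-identityʳ w)) completes) blueY

-- The upper bound

private
  twice-a : ∀ p → 6 + 2 * p ≡ (3 + p) + (3 + p)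
  twice-a = solve-∀
  a-times-2s : ∀ p s → (3 + p) * (2 * s) ≡ s * (6 + 2 * p)
  a-times-2s = solve-∀

upperBound : ∀ p T k n → 6 + 2 * p ≤ k → k ≤ T → 3 + p + T ≤ (3 + p) * k →
             (3 + p + T) * k ≤ (3 + p) * n → Forced (suc (3 + p + T)) (3 + p) n
upperBound p T k n 2a≤k k≤T s≤ak sk≤an c = byFirstBlue (firstBlue c k)
  where
  open TwoColours n c

  a≤T : 3 + p ≤ T
  a≤T = ≤-trans (≤-offset (3 + p) (twice-a p)) (≤-trans 2a≤k k≤T)

  2s≤n : 2 * (3 + p + T) ≤ n
  2s≤n = *-cancelˡ-≤ (3 + p) (begin
    (3 + p) * (2 * (3 + p + T))  ≡⟨ a-times-2s p (3 + p + T) ⟩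
    (3 + p + T) * (6 + 2 * p)    ≤⟨ *-monoʳ-≤ (3 + p + T) 2a≤k ⟩
    (3 + p + T) * k              ≤⟨ sk≤an ⟩
    (3 + p) * n                  ∎)
    where open ≤-Reasoning

  2t≤n : 2 * suc T ≤ n
  2t≤n = ≤-trans (*-monoʳ-≤ 2 (s≤s (m≤n+m T (2 + p)))) 2s≤n

  2≤k : 2 ≤ k
  2≤k = ≤-trans (s≤s (s≤s z≤n)) 2a≤k

  k≤n : k ≤ n
  k≤n = ≤-trans k≤T (≤-trans (≤-trans (n≤1+n T) (m≤m+n (suc T) (suc T + 0))) 2t≤n)

  byFirstBlue : FirstBlue c k → MonoSolution (suc (3 + p + T)) (3 + p) n c
  byFirstBlue (inj₁ allRed) =
    Red.fill (2 + p) T 2≤k (λ x 1≤x x≤k → (1≤x , ≤-trans x≤k k≤n) , allRed x 1≤x x≤k)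
      ((1≤k , k≤n) , allRed k 1≤k ≤-refl) s≤ak (m≤n*m k (suc T))
    where
    1≤k : 1 ≤ k
    1≤k = ≤-trans (s≤s z≤n) 2≤k
  byFirstBlue (inj₂ (zero , _ , blue2 , _)) =
    secondBlue p T n c (≤-trans (m≤m+n 6 (2 * p)) (≤-trans 2a≤k k≤T)) 2t≤n blue2
  byFirstBlue (inj₂ (suc e , b≤k , blueB , belowRed)) =
    LargeFirstBlue.result p T k n c e b≤k blueB belowRed k≤T a≤T s≤ak sk≤an 2t≤n

radoNumber : ∀ p s → (3 + p) * (5 + 2 * p) < s →
  IsRadoNumber (suc s) (3 + p) (ceilDiv (s * ceilDiv s (3 + p)) (3 + p))
radoNumber p s s-large
  with m≤n⇒∃[o]m+o≡n (≤-trans (m≤m*n (3 + p) (5 + 2 * p)) (<⇒≤ s-large))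
... | T , refl = 1≤n , upperBound p T k n 2a≤k k≤T s≤ak sk≤an , notForced
  where
  k : ℕ
  k = ceilDiv (3 + p + T) (3 + p)
  n : ℕ
  n = ceilDiv ((3 + p + T) * k) (3 + p)

  s≤ak : 3 + p + T ≤ (3 + p) * k
  s≤ak = ceilDiv-lower (3 + p + T) (2 + p)
  ak≤ : (3 + p) * k ≤ 3 + p + T + (2 + p)
  ak≤ = ceilDiv-upper (3 + p + T) (2 + p)
  sk≤an : (3 + p + T) * k ≤ (3 + p) * n
  sk≤an = ceilDiv-lower ((3 + p + T) * k) (2 + p)
  an≤ : (3 + p) * n ≤ (3 + p + T) * k + (2 + p)
  an≤ = ceilDiv-upper ((3 + p + T) * k) (2 + p)

  2a≤k : 6 + 2 * p ≤ k
  2a≤k = *-cancelˡ-< (3 + p) (5 + 2 * p) k (<-≤-trans s-large s≤ak)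

  a≤T : 3 + p ≤ T
  a≤T = ≤-trans (m≤m*n (3 + p) (4 + 2 * p))
    (<⇒≤ (+-cancelˡ-< (3 + p) _ T (subst (_< 3 + p + T) (*-suc (3 + p) (4 + 2 * p)) s-large)))

  -- a·k ≤ s + (a − 1) ≤ a·T + (a − 1), as s = a + T ≤ a·T
  k≤T : k ≤ T
  k≤T = *-cancel-slack (2 + p) k T (≤-trans ak≤ (+-monoˡ-≤ (2 + p)
          (+≤* (3 + p) T (s≤s (s≤s z≤n)) (≤-trans (s≤s (s≤s z≤n)) a≤T))))

  1≤n : 1 ≤ n
  1≤n = factor-positive (3 + p) n (≤-trans (s≤s z≤n) (≤-trans s≤sk sk≤an))
    where
    s≤sk : 3 + p + T ≤ (3 + p + T) * k
    s≤sk = subst (_≤ (3 + p + T) * k) (*-identityʳ (3 + p + T))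
             (*-monoʳ-≤ (3 + p + T) (≤-trans (s≤s z≤n) 2a≤k))

  notForced : ∀ n′ → 1 ≤ n′ → n′ < n → ¬ Forced (suc (3 + p + T)) (3 + p) n′
  notForced n′ _ n′<n forced = thresholdAvoids (3 + p + T) (3 + p) k n′
    (≤-<-trans ak≤ (+-monoʳ-< (3 + p + T) (n<1+n (2 + p))))
    (≤-<-trans (*-monoʳ-≤ (3 + p) n′<n) (≤-<-trans an≤ (+-monoʳ-< _ (n<1+n (2 + p)))))
    (forced (threshold k))

private
  twice-square : ∀ p → 2 * ((3 + p) * (3 + p)) ≡ (3 + p) + (3 + p) * (5 + 2 * p)
  twice-square = solve-∀

summandBound : ∀ p m → 2 * ((3 + p) * (3 + p)) ∸ (3 + p) + 2 ≤ m →
               (3 + p) * (5 + 2 * p) < m ∸ 1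
summandBound p m m-large = subst (_≤ m ∸ 1) (cong (_∸ 1) (+-comm X 2)) (∸-monoˡ-≤ 1 X+2≤m)
  where
  X : ℕ
  X = (3 + p) * (5 + 2 * p)
  X+2≤m : X + 2 ≤ m
  X+2≤m = subst (λ z → z + 2 ≤ m)
            (trans (cong (_∸ (3 + p)) (twice-square p)) (m+n∸m≡n (3 + p) X)) m-large

theorem1 : (a m : ℕ) → .{{_ : NonZero a}} → 3 ≤ a → 2 * (a * a) ∸ a + 2 ≤ m →
    IsRadoNumber m a (ceilDiv ((m ∸ 1) * ceilDiv (m ∸ 1) a) a)
theorem1 a m 3≤a m-large with m≤n⇒∃[o]m+o≡n 3≤a
... | p , refl =
  subst (λ m′ → IsRadoNumber m′ (3 + p) (ceilDiv ((m ∸ 1) * ceilDiv (m ∸ 1) (3 + p)) (3 + p)))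
        (m+[n∸m]≡n 1≤m)
        (radoNumber p (m ∸ 1) (summandBound p m m-large))
  where
  1≤m : 1 ≤ m
  1≤m = ≤-trans (s≤s z≤n) (≤-trans (m≤n+m 2 _) m-large)
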